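{- Let $\Sigma=\{c_1<\dots<c_{|\Sigma|}\}$, let $x\in\Sigma^n$ and $m=\mathsf{MTF}(x)=(m_1,\dots,m_n)$ with initial stack $S_0=(c_1,\dots,c_{|\Sigma|})$, and for $0\le i\le n$ let $S_i$ be the MTF stack after encoding $x[1:i]$. For $0\le i<j\le n$ let $\pi_{i,j}\in\mathcal{S}_{|\Sigma|}$ be the unique permutation with $S_j=\pi_{i,j}\circ S_i$. Then $\pi_{i,j}$ depends only on $m[i+1:j]$ and not on $S_i$ or $S_j$: for any stack $T$ (ordering of $\Sigma$), if running the MTF decoder on $m[i+1:j]$ starting from stack $T$ ends at stack $T'$, then $T'=\pi_{i,j}\circ T$. In particular $\pi_{i,j}$ is obtained by simulating the MTF decoder on $m[i+1:j]$ starting from the identity stack $S_0$.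
   Context: An MTF stack is an ordering $S=(a_1,\dots,a_{|\Sigma|})$ of $\Sigma$, with $S[k]=a_k$ the character at position $k$ from the top. MTF encoding: to encode character $c$ with current stack $S$, output $k-1$ where $S[k]=c$, then move $c$ to the top. MTF decoding of a symbol $m_i$ from stack $S$: output $S[m_i+1]$ and move it to the top. For a stack $S$ and $\pi\in\mathcal{S}_{|\Sigma|}$, $S'=\pi\circ S$ is the stack with $S'[\pi(k)]=S[k]$ for all $k$. -}

module Defs where

open import Data.Nat using (ℕ; zero; suc; _∸_)
open import Data.Fin using (Fin; zero; suc)
open import Data.Vec using (Vec; []; _∷_; lookup; tabulate; allFin)
open import Data.List using (List; []; _∷_; take; drop)
open import Data.Product using (_×_; _,_; proj₁; proj₂)
open import Data.Vec.Relation.Unary.Any using (any?; index)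
open import Data.Fin.Permutation using (Permutation′; _⟨$⟩ˡ_)
open import Relation.Binary.PropositionalEquality using (_≡_)
open import Relation.Nullary using (yes; no)
open import Data.Fin using (_≟_)

-- Alphabet Σ = Fin σ, ordered c₁ < … < c_σ as zero < 1 < … .
-- A stack is a vector of length σ; position k (0-based Fin) = S[k+1].
Stack : ℕ → Set
Stack σ = Vec (Fin σ) σ

moveToTop : ∀ {A : Set} {n} → Vec A n → Fin n → Vec A n
moveToTop (a ∷ v) zero = a ∷ v
moveToTop {n = suc (suc _)} (a ∷ v) (suc k) with moveToTop v k
... | b ∷ w = b ∷ a ∷ w

-- Position (0-based) of c in the stack S.  For an ordering of Σ the
-- element is always found; the fallback branch is never used for orderings.
position : ∀ {σ} → Stack σ → Fin σ → Fin σ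
position S c with any? (c ≟_) S
... | yes p = index p
... | no _ = c

encodeStep : ∀ {σ} → Stack σ → Fin σ → Fin σ × Stack σ
encodeStep S c = position S c , moveToTop S (position S c)

mtfEncode : ∀ {σ} → Stack σ → List (Fin σ) → List (Fin σ) × Stack σ
mtfEncode S [] = [] , S
mtfEncode S (c ∷ cs) with encodeStep S c
... | (m , S′) = m ∷ proj₁ (mtfEncode S′ cs) , proj₂ (mtfEncode S′ cs)

-- Stack reached by running the MTF decoder on the symbols ms from T
-- (decoding mᵢ outputs T[mᵢ+1] and moves it to the top).
decodeStack : ∀ {σ} → Stack σ → List (Fin σ) → Stack σ
decodeStack T [] = T
decodeStack T (m ∷ ms) = decodeStack (moveToTop T m) ms

initStack : ∀ σ → Stack σ
initStack σ = allFin σ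

stackAfter : ∀ {σ} → List (Fin σ) → ℕ → Stack σ
stackAfter {σ} x i = proj₂ (mtfEncode (initStack σ) (take i x))

MTF : ∀ {σ} → List (Fin σ) → List (Fin σ)
MTF {σ} x = proj₁ (mtfEncode (initStack σ) x)

-- m[i+1:j] (1-based, inclusive)
slice : ∀ {A : Set} → List A → ℕ → ℕ → List A
slice xs i j = take (j ∸ i) (drop i xs)

-- π ∘ S : the stack S′ with S′[π(k)] = S[k], i.e. S′[k] = S[π⁻¹(k)].
_⊙_ : ∀ {A : Set} {σ} → Permutation′ σ → Vec A σ → Vec A σ
π ⊙ S = tabulate (λ k → lookup S (π ⟨$⟩ˡ k))

-- Moving the entry at position k to the top rearranges positions in a
-- way that depends on k only, never on the contents of the stack: it is the
-- action  T ↦ ρₖ ⊙ T  of a fixed permutation ρₖ (ρ₀ = id, and ρ_{k+1} is ρₖ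
-- acting below the top followed by a swap of the two top entries).  Hence the
-- decoder run on a symbol list ms acts on every stack by one permutation
-- decoderPerm ms, the composite of the ρ's.  Since the decoder undoes the
-- encoder, decoding m[i+1:j] from S_i reaches S_j, so π = decoderPerm m[i+1:j]
-- satisfies S_j = π ⊙ S_i and acts the same way on every stack T.
-- Uniqueness: S_i = P ⊙ S₀ for a permutation P, and a permutation is
-- recovered from its action on a stack without repetitions such as S₀.
module Submission where

open import Defs
open import Data.Nat using (ℕ; _<_; _≤_; zero; suc; _∸_; z≤n; s≤s)
open import Data.Nat.Properties using (<⇒≤)
open import Data.Fin using (Fin; zero; suc)
open import Data.Fin.Patterns using (0F; 1F)
open import Data.List using (List; length; []; _∷_; take)
open import Data.List.Properties using (take-all)
open import Data.Vec using (Vec; _∷_; lookup)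
open import Data.Vec.Properties using (lookup∘tabulate; tabulate∘lookup; tabulate-cong)
open import Data.Vec.Relation.Unary.Unique.Propositional using (Unique)
open import Data.Vec.Relation.Unary.Unique.Propositional.Properties using (lookup-injective; tabulate⁺)
open import Data.Product using (Σ; _×_; _,_; proj₁; proj₂)
open import Data.Fin.Permutation
  using (Permutation′; _⟨$⟩ʳ_; _⟨$⟩ˡ_; _≈_; id; _∘ₚ_; lift₀; transpose; inverseʳ; inverseˡ)
open import Relation.Binary.PropositionalEquality
open ≡-Reasoning

⊙-lookup : ∀ {A : Set} {n} (π : Permutation′ n) (T : Vec A n) (k : Fin n) →
  lookup (π ⊙ T) k ≡ lookup T (π ⟨$⟩ˡ k)
⊙-lookup π T k = lookup∘tabulate _ k

⊙-id : ∀ {A : Set} {n} (T : Vec A n) → id ⊙ T ≡ T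
⊙-id T = tabulate∘lookup T

⊙-∘ : ∀ {A : Set} {n} (ρ π : Permutation′ n) (T : Vec A n) →
  π ⊙ (ρ ⊙ T) ≡ (ρ ∘ₚ π) ⊙ T
⊙-∘ ρ π T = tabulate-cong (λ k → ⊙-lookup ρ T (π ⟨$⟩ˡ k))

⊙-lift₀ : ∀ {A : Set} {n} (π : Permutation′ n) (a : A) (v : Vec A n) →
  lift₀ π ⊙ (a ∷ v) ≡ a ∷ (π ⊙ v)
⊙-lift₀ π a v = refl

⊙-swapTop : ∀ {A : Set} {n} (a b : A) (w : Vec A n) →
  transpose 0F 1F ⊙ (a ∷ b ∷ w) ≡ b ∷ a ∷ w
⊙-swapTop a b w = cong (λ t → b ∷ a ∷ t) (tabulate∘lookup w)

≈-from-inverses : ∀ {n} (π π′ : Permutation′ n) →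
  (∀ z → π ⟨$⟩ˡ z ≡ π′ ⟨$⟩ˡ z) → π ≈ π′
≈-from-inverses π π′ same k = begin
  π ⟨$⟩ʳ k                     ≡⟨ cong (π ⟨$⟩ʳ_) (sym (inverseˡ π′)) ⟩
  π ⟨$⟩ʳ (π′ ⟨$⟩ˡ (π′ ⟨$⟩ʳ k))  ≡⟨ cong (π ⟨$⟩ʳ_) (sym (same (π′ ⟨$⟩ʳ k))) ⟩
  π ⟨$⟩ʳ (π ⟨$⟩ˡ (π′ ⟨$⟩ʳ k))   ≡⟨ inverseʳ π ⟩
  π′ ⟨$⟩ʳ k                    ∎

⊙-faithful : ∀ {A : Set} {n} (π π′ : Permutation′ n) (T : Vec A n) → Unique T →
  π ⊙ T ≡ π′ ⊙ T → π ≈ π′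
⊙-faithful π π′ T uniqueT eq = ≈-from-inverses π π′ λ z →
  lookup-injective uniqueT _ _ (begin
    lookup T (π ⟨$⟩ˡ z)   ≡⟨ sym (⊙-lookup π T z) ⟩
    lookup (π ⊙ T) z     ≡⟨ cong (λ S → lookup S z) eq ⟩
    lookup (π′ ⊙ T) z    ≡⟨ ⊙-lookup π′ T z ⟩
    lookup T (π′ ⟨$⟩ˡ z)  ∎)

-- Faithfulness survives a common permutation applied first, since
-- π ⊙ (ρ ⊙ T) = (ρ ∘ₚ π) ⊙ T and ρ can then be cancelled.
⊙-cancel : ∀ {A : Set} {n} (π π′ ρ : Permutation′ n) (T : Vec A n) → Unique T →
  π ⊙ (ρ ⊙ T) ≡ π′ ⊙ (ρ ⊙ T) → π ≈ π′
⊙-cancel π π′ ρ T uniqueT eq k = begin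
  π ⟨$⟩ʳ k                         ≡⟨ cong (π ⟨$⟩ʳ_) (sym (inverseʳ ρ)) ⟩
  (ρ ∘ₚ π) ⟨$⟩ʳ (ρ ⟨$⟩ˡ k)          ≡⟨ composites-agree (ρ ⟨$⟩ˡ k) ⟩
  (ρ ∘ₚ π′) ⟨$⟩ʳ (ρ ⟨$⟩ˡ k)         ≡⟨ cong (π′ ⟨$⟩ʳ_) (inverseʳ ρ) ⟩
  π′ ⟨$⟩ʳ k                        ∎
  where
  composites-agree : (ρ ∘ₚ π) ≈ (ρ ∘ₚ π′)
  composites-agree = ⊙-faithful (ρ ∘ₚ π) (ρ ∘ₚ π′) T uniqueT
    (trans (sym (⊙-∘ ρ π T)) (trans eq (⊙-∘ ρ π′ T)))

initStack-unique : ∀ σ → Unique (initStack σ)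
initStack-unique σ = tabulate⁺ (λ eq → eq)

moveToTop-suc : ∀ {A : Set} {n} (a : A) (v : Vec A (suc n)) (k : Fin (suc n)) →
  moveToTop (a ∷ v) (suc k) ≡ transpose 0F 1F ⊙ (a ∷ moveToTop v k)
moveToTop-suc a v k with moveToTop v k
... | b ∷ w = sym (⊙-swapTop a b w)

moveToTopPerm : ∀ {n} → Fin n → Permutation′ n
moveToTopPerm zero = id
moveToTopPerm {suc (suc n)} (suc k) = lift₀ (moveToTopPerm k) ∘ₚ transpose 0F 1F

moveToTop-⊙ : ∀ {A : Set} {n} (T : Vec A n) (k : Fin n) →
  moveToTop T k ≡ moveToTopPerm k ⊙ T
moveToTop-⊙ (a ∷ v) zero = sym (⊙-id (a ∷ v))
moveToTop-⊙ {n = suc (suc n)} (a ∷ v) (suc k) = begin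
  moveToTop (a ∷ v) (suc k)                                 ≡⟨ moveToTop-suc a v k ⟩
  transpose 0F 1F ⊙ (a ∷ moveToTop v k)                     ≡⟨ cong (λ t → transpose 0F 1F ⊙ (a ∷ t)) (moveToTop-⊙ v k) ⟩
  transpose 0F 1F ⊙ (a ∷ (ρ ⊙ v))                           ≡⟨ cong (transpose 0F 1F ⊙_) (sym (⊙-lift₀ ρ a v)) ⟩
  transpose 0F 1F ⊙ (lift₀ ρ ⊙ (a ∷ v))                     ≡⟨ ⊙-∘ (lift₀ ρ) (transpose 0F 1F) (a ∷ v) ⟩
  (lift₀ ρ ∘ₚ transpose 0F 1F) ⊙ (a ∷ v)                    ∎
  where
  ρ : Permutation′ (suc n)
  ρ = moveToTopPerm k

decoderPerm : ∀ {σ} → List (Fin σ) → Permutation′ σ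
decoderPerm [] = id
decoderPerm (m ∷ ms) = moveToTopPerm m ∘ₚ decoderPerm ms

decodeStack-⊙ : ∀ {σ} (T : Stack σ) (ms : List (Fin σ)) →
  decodeStack T ms ≡ decoderPerm ms ⊙ T
decodeStack-⊙ T [] = sym (⊙-id T)
decodeStack-⊙ T (m ∷ ms) = begin
  decodeStack (moveToTop T m) ms                  ≡⟨ decodeStack-⊙ (moveToTop T m) ms ⟩
  decoderPerm ms ⊙ moveToTop T m                  ≡⟨ cong (decoderPerm ms ⊙_) (moveToTop-⊙ T m) ⟩
  decoderPerm ms ⊙ (moveToTopPerm m ⊙ T)          ≡⟨ ⊙-∘ (moveToTopPerm m) (decoderPerm ms) T ⟩
  (moveToTopPerm m ∘ₚ decoderPerm ms) ⊙ T         ∎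

decode-encode : ∀ {σ} (S : Stack σ) (xs : List (Fin σ)) →
  decodeStack S (proj₁ (mtfEncode S xs)) ≡ proj₂ (mtfEncode S xs)
decode-encode S [] = refl
decode-encode S (c ∷ cs) = decode-encode (moveToTop S (position S c)) cs

encode-take : ∀ {σ} (S : Stack σ) (j : ℕ) (xs : List (Fin σ)) →
  proj₁ (mtfEncode S (take j xs)) ≡ take j (proj₁ (mtfEncode S xs))
encode-take S zero xs = refl
encode-take S (suc j) [] = refl
encode-take S (suc j) (c ∷ cs) =
  cong (position S c ∷_) (encode-take (moveToTop S (position S c)) j cs)

decode-slice : ∀ {σ} (S : Stack σ) (i j : ℕ) (xs : List (Fin σ)) → i ≤ j →
  decodeStack (proj₂ (mtfEncode S (take i xs)))
              (slice (proj₁ (mtfEncode S xs)) i j)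
  ≡ proj₂ (mtfEncode S (take j xs))
decode-slice S zero j xs z≤n = begin
  decodeStack S (take j (proj₁ (mtfEncode S xs)))      ≡⟨ cong (decodeStack S) (sym (encode-take S j xs)) ⟩
  decodeStack S (proj₁ (mtfEncode S (take j xs)))      ≡⟨ decode-encode S (take j xs) ⟩
  proj₂ (mtfEncode S (take j xs))                      ∎
decode-slice S (suc i) (suc j) [] (s≤s i≤j) = cong (decodeStack S) (take-all (j ∸ i) [] z≤n)
decode-slice S (suc i) (suc j) (c ∷ cs) (s≤s i≤j) =
  decode-slice (moveToTop S (position S c)) i j cs i≤j

stackAfter-⊙ : ∀ {σ} (x : List (Fin σ)) (i : ℕ) →
  stackAfter x i ≡ decoderPerm (MTF (take i x)) ⊙ initStack σ
stackAfter-⊙ {σ} x i = begin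
  stackAfter x i                              ≡⟨ sym (decode-encode (initStack σ) (take i x)) ⟩
  decodeStack (initStack σ) (MTF (take i x))  ≡⟨ decodeStack-⊙ (initStack σ) (MTF (take i x)) ⟩
  decoderPerm (MTF (take i x)) ⊙ initStack σ  ∎

proposition1 : (σ : ℕ) (x : List (Fin σ)) (i j : ℕ) → i < j → j ≤ length x →
    Σ (Permutation′ σ) λ π →
    (stackAfter x j ≡ π ⊙ stackAfter x i)
    × ((π′ : Permutation′ σ) → stackAfter x j ≡ π′ ⊙ stackAfter x i →
    (k : Fin σ) → π′ ⟨$⟩ʳ k ≡ π ⟨$⟩ʳ k)
    × ((T : Stack σ) → Unique T →
    decodeStack T (slice (MTF x) i j) ≡ π ⊙ T)
proposition1 σ x i j i<j _ = π , step , unique , (λ T _ → decodeStack-⊙ T ms)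
  where
  ms : List (Fin σ)
  ms = slice (MTF x) i j

  π : Permutation′ σ
  π = decoderPerm ms

  step : stackAfter x j ≡ π ⊙ stackAfter x i
  step = trans (sym (decode-slice (initStack σ) i j x (<⇒≤ i<j)))
               (decodeStack-⊙ (stackAfter x i) ms)

  unique : (π′ : Permutation′ σ) → stackAfter x j ≡ π′ ⊙ stackAfter x i → π′ ≈ π
  unique π′ step′ = ⊙-cancel π′ π P (initStack σ) (initStack-unique σ)
    (begin
      π′ ⊙ (P ⊙ initStack σ)  ≡⟨ cong (π′ ⊙_) (sym (stackAfter-⊙ x i)) ⟩
      π′ ⊙ stackAfter x i     ≡⟨ sym step′ ⟩
      stackAfter x j          ≡⟨ step ⟩
      π ⊙ stackAfter x i      ≡⟨ cong (π ⊙_) (stackAfter-⊙ x i) ⟩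
      π ⊙ (P ⊙ initStack σ)   ∎)
    where
    P : Permutation′ σ
    P = decoderPerm (MTF (take i x))
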